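{- Let $n\ge1$, $\sigma\in\mathfrak S_n$, $j\in[n]$ and $k=\hat\sigma(j)$. Then $k<\sigma(k)$ and $k<\sigma^{ -1}(k)$ hold if and only if $j\ne1$ and either $j\le n-1$ with $\hat\sigma(j)<\hat\sigma(j-1)$ and $\hat\sigma(j)<\hat\sigma(j+1)$, or $j=n$ with $\hat\sigma(j)<\hat\sigma(j-1)$.
   Context: $[n]=\{1,\dots,n\}$, $\mathfrak S_n$ the symmetric group on $[n]$. For $\sigma\in\mathfrak S_n$ and $k\in[n]$, let $\bar k$ be the largest element of the $\sigma$-orbit of $k$, $q_k=\min\{p\ge0:\sigma^p(k)=\bar k\}$, and $\Pi_\sigma(k)=(\bar k,q_k)$. The permutation $\hat\sigma\in\mathfrak S_n$ is the unique one such that $\Pi_\sigma(\hat\sigma(1)),\dots,\Pi_\sigma(\hat\sigma(n))$ is increasing in lexicographic order. -}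

module Defs where

open import Data.Nat using (ℕ; zero; suc; _≤_; _<_)
open import Data.Fin using (Fin; toℕ)
open import Data.Fin.Permutation using (Permutation′; _⟨$⟩ʳ_)
open import Data.Product using (Σ; ∃; _×_; _,_)
open import Data.Sum using (_⊎_)
open import Relation.Binary.PropositionalEquality using (_≡_)

iter : ∀ {n} → Permutation′ n → ℕ → Fin n → Fin n
iter σ zero    k = k
iter σ (suc p) k = σ ⟨$⟩ʳ (iter σ p k)

InOrbit : ∀ {n} → Permutation′ n → Fin n → Fin n → Set
InOrbit σ k m = ∃ λ p → iter σ p k ≡ m

IsOrbitMax : ∀ {n} → Permutation′ n → Fin n → Fin n → Set
IsOrbitMax σ k m = InOrbit σ k m × (∀ m′ → InOrbit σ k m′ → toℕ m′ ≤ toℕ m)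

IsΠ : ∀ {n} → Permutation′ n → Fin n → Fin n → ℕ → Set
IsΠ σ k m q = IsOrbitMax σ k m × iter σ q k ≡ m × (∀ p → iter σ p k ≡ m → q ≤ p)

LexLt : ℕ × ℕ → ℕ × ℕ → Set
LexLt (a , b) (c , d) = (a < c) ⊎ (a ≡ c × b < d)

IsHat : ∀ {n} → Permutation′ n → Permutation′ n → Set
IsHat {n} σ τ = ∀ (i j : Fin n) → toℕ i < toℕ j →
  ∀ a qa b qb → IsΠ σ (τ ⟨$⟩ʳ i) a qa → IsΠ σ (τ ⟨$⟩ʳ j) b qb →
  LexLt (toℕ a , qa) (toℕ b , qb)

-- the entry of τ at the (0-based) position i is smaller than the entry at (0-based) position m
BelowAt : ∀ {n} → Permutation′ n → Fin n → ℕ → Set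
BelowAt {n} τ i m = Σ (Fin n) λ i′ → toℕ i′ ≡ m × toℕ (τ ⟨$⟩ʳ i) < toℕ (τ ⟨$⟩ʳ i′)

{-# OPTIONS --safe #-}
module Submission where

-- σ̂ lists every orbit as a contiguous block  m, σ⁻¹ m, σ⁻² m, …  starting at its maximum m,
-- the blocks ordered by their maxima. So the left neighbour of an entry k that does not start
-- a block is σ k, while an entry that starts a block exceeds everything before it. Hence
-- k < σ k iff k has a larger left neighbour. In that case k ≠ m, and σ⁻¹ k is either the right
-- neighbour of k or, when k ends its block, the maximum m > k; then the right neighbour, if
-- any, starts a new block and exceeds k as well.

open import Defs
open import Data.Nat using (ℕ; zero; suc; _<_; _∸_; _≤_; _+_; z≤n; s≤s; s≤s⁻¹; ≢-nonZero)
open import Data.Nat.Properties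
open import Data.Fin using (Fin; toℕ; fromℕ<)
open import Data.Fin.Properties using (toℕ-injective; toℕ-fromℕ<; toℕ<n; pigeonhole)
  renaming (_≟_ to _≟ᶠ_)
open import Data.Fin.Permutation using (Permutation′; _⟨$⟩ʳ_; _⟨$⟩ˡ_; inverseˡ; inverseʳ)
open import Data.List using (upTo)
open import Data.List.Extrema ≤-totalOrder using (argmax; f[xs]≤f[argmax])
open import Data.List.Membership.Propositional.Properties using (∈-upTo⁺)
open import Data.List.Relation.Unary.All using (lookup)
open import Data.Product using (_×_; _,_; ∃; ∃₂; proj₁; proj₂)
open import Data.Sum using (_⊎_; inj₁; inj₂; [_,_]′)
import Data.Sum as Sum
open import Function.Base using (id; _∘_)
open import Function.Bundles using (_⇔_; mk⇔; Injection)
open import Function.Properties.Inverse using (↔⇒↣)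
open import Relation.Nullary using (¬_; contradiction; yes; no)
open import Relation.Unary using (Pred; Decidable)
open import Relation.Binary.Definitions using (tri<; tri≈; tri>)
open import Relation.Binary.PropositionalEquality

⟨$⟩ʳ-injective : ∀ {n} (π : Permutation′ n) {x y : Fin n} → π ⟨$⟩ʳ x ≡ π ⟨$⟩ʳ y → x ≡ y
⟨$⟩ʳ-injective π = Injection.injective (↔⇒↣ π)

LexLt-irrefl : ∀ {a b} → ¬ LexLt (a , b) (a , b)
LexLt-irrefl (inj₁ a<a)       = <-irrefl refl a<a
LexLt-irrefl (inj₂ (_ , b<b)) = <-irrefl refl b<b

LexLt-asym : ∀ {a b c d} → LexLt (a , b) (c , d) → ¬ LexLt (c , d) (a , b)
LexLt-asym (inj₁ a<c)        (inj₁ c<a)        = <-asym a<c c<a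
LexLt-asym (inj₁ a<c)        (inj₂ (refl , _)) = <-irrefl refl a<c
LexLt-asym (inj₂ (refl , _)) (inj₁ c<a)        = <-irrefl refl c<a
LexLt-asym (inj₂ (_ , b<d))  (inj₂ (_ , d<b))  = <-asym b<d d<b

LexLt-between : ∀ {a q c d} → LexLt (a , q) (c , d) → ¬ LexLt (c , d) (a , suc q)
LexLt-between (inj₁ a<c)        (inj₁ c<a)        = <-asym a<c c<a
LexLt-between (inj₁ a<c)        (inj₂ (refl , _)) = <-irrefl refl a<c
LexLt-between (inj₂ (refl , _)) (inj₁ c<a)        = <-irrefl refl c<a
LexLt-between (inj₂ (_ , q<d))  (inj₂ (_ , d<1+q)) = <⇒≱ q<d (s≤s⁻¹ d<1+q)

module _ {p} {P : Pred ℕ p} (P? : Decidable P) where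

  private
    search : ∀ b → (∀ {i} → i < b → ¬ P i) ⊎ ∃ λ q → P q × (∀ {i} → i < q → ¬ P i)
    search zero = inj₁ λ ()
    search (suc b) with search b | P? b
    ... | inj₂ found | _      = inj₂ found
    ... | inj₁ none  | yes Pb = inj₂ (b , Pb , none)
    ... | inj₁ none  | no ¬Pb = inj₁ λ i<1+b →
      [ none , (λ { refl → ¬Pb }) ]′ (m≤n⇒m<n∨m≡n (s≤s⁻¹ i<1+b))

  least-witness : ∀ {q₀} → P q₀ → ∃ λ q → P q × (∀ {i} → P i → q ≤ i)
  least-witness {q₀} Pq₀ with search (suc q₀)
  ... | inj₁ none              = contradiction Pq₀ (none ≤-refl)
  ... | inj₂ (q , Pq , below) = q , Pq , λ Pi → ≮⇒≥ λ i<q → below i<q Pi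

module _ {n} (σ : Permutation′ n) where

  iter-+ : ∀ a c x → iter σ (a + c) x ≡ iter σ a (iter σ c x)
  iter-+ zero    c x = refl
  iter-+ (suc a) c x = cong (σ ⟨$⟩ʳ_) (iter-+ a c x)

  iter-suc : ∀ p x → iter σ p (σ ⟨$⟩ʳ x) ≡ iter σ (suc p) x
  iter-suc p x = trans (sym (iter-+ p 1 x)) (cong (λ t → iter σ t x) (+-comm p 1))

  iter-cancelˡ : ∀ a c x → iter σ a (iter σ c x) ≡ iter σ a x → iter σ c x ≡ x
  iter-cancelˡ zero    c x eq = eq
  iter-cancelˡ (suc a) c x eq = iter-cancelˡ a c x (⟨$⟩ʳ-injective σ eq)

  iter-periodic : ∀ x → ∃ λ P → iter σ (suc P) x ≡ x
  iter-periodic x with pigeonhole (n<1+n n) (λ i → iter σ (toℕ i) x)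
  ... | i , j , i<j , eq = P , iter-cancelˡ (toℕ i) (suc P) x (begin
      iter σ (toℕ i) (iter σ (suc P) x) ≡⟨ iter-+ (toℕ i) (suc P) x ⟨
      iter σ (toℕ i + suc P) x          ≡⟨ cong (λ t → iter σ t x) (trans (+-suc (toℕ i) P) (m+[n∸m]≡n i<j)) ⟩
      iter σ (toℕ j) x                  ≡⟨ eq ⟨
      iter σ (toℕ i) x                  ∎)
    where
    open ≡-Reasoning
    P = toℕ j ∸ suc (toℕ i)

  iter-reduce : ∀ {x P} → iter σ (suc P) x ≡ x → ∀ p → ∃ λ r → r ≤ P × iter σ p x ≡ iter σ r x
  iter-reduce period zero = 0 , z≤n , refl
  iter-reduce period (suc p) with iter-reduce period p
  ... | r , r≤P , eq with m≤n⇒m<n∨m≡n r≤P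
  ...   | inj₁ r<P  = suc r , r<P , cong (σ ⟨$⟩ʳ_) eq
  ...   | inj₂ refl = 0 , z≤n , trans (cong (σ ⟨$⟩ʳ_) eq) period

  orbit-max : ∀ x → ∃ λ r → ∀ y → InOrbit σ x y → toℕ y ≤ toℕ (iter σ r x)
  orbit-max x = r , bounded
    where
    P = proj₁ (iter-periodic x)
    f : ℕ → ℕ
    f p = toℕ (iter σ p x)
    r = argmax f 0 (upTo (suc P))
    bounded : ∀ y → InOrbit σ x y → toℕ y ≤ toℕ (iter σ r x)
    bounded y (p , refl) with iter-reduce (proj₂ (iter-periodic x)) p
    ... | r′ , r′≤P , eq rewrite eq =
      lookup (f[xs]≤f[argmax] {f = f} 0 (upTo (suc P))) (∈-upTo⁺ (s≤s r′≤P))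

  Π-exists : ∀ x → ∃₂ λ m q → IsΠ σ x m q
  Π-exists x with orbit-max x
  ... | r , bounded with least-witness (λ p → iter σ p x ≟ᶠ iter σ r x) {r} refl
  ...   | q , hit , least = iter σ r x , q , ((r , refl) , bounded) , hit , λ _ → least

  Π-unique : ∀ {x m q m′ q′} → IsΠ σ x m q → IsΠ σ x m′ q′ → m ≡ m′ × q ≡ q′
  Π-unique ((x↝m , m-max) , hit , least) ((x↝m′ , m′-max) , hit′ , least′) =
    m≡m′ , ≤-antisym (least _ (trans hit′ (sym m≡m′))) (least′ _ (trans hit m≡m′))
    where m≡m′ = toℕ-injective (≤-antisym (m′-max _ x↝m) (m-max _ x↝m′))

  IsΠ-σ : ∀ {x m q} → IsΠ σ x m (suc q) → IsΠ σ (σ ⟨$⟩ʳ x) m q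
  IsΠ-σ {x} {q = q} ((_ , m-max) , hit , least) =
    ((q , hit′) , λ y (p , e) → m-max y (suc p , trans (sym (iter-suc p x)) e)) ,
    hit′ , λ p e → s≤s⁻¹ (least (suc p) (trans (sym (iter-suc p x)) e))
    where hit′ = trans (iter-suc q x) hit

  IsΠ⇒≤ : ∀ {x m q} → IsΠ σ x m q → toℕ x ≤ toℕ m
  IsΠ⇒≤ ((_ , m-max) , _) = m-max _ (0 , refl)

  IsΠ⇒σ≤ : ∀ {x m q} → IsΠ σ x m q → toℕ (σ ⟨$⟩ʳ x) ≤ toℕ m
  IsΠ⇒σ≤ ((_ , m-max) , _) = m-max _ (1 , refl)

Adjacent : ∀ {n} → Fin n → Fin n → Set
Adjacent i p = suc (toℕ i) ≡ toℕ p

CycleValley : ∀ {n} → Permutation′ n → Fin n → Set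
CycleValley σ k = toℕ k < toℕ (σ ⟨$⟩ʳ k) × toℕ k < toℕ (σ ⟨$⟩ˡ k)

-- A valley of the word τ(0) τ(1) … τ(n-1) with τ(n) read as +∞ and no valley at position 0.
WordValley : ∀ {n} → Permutation′ n → Fin n → Set
WordValley {n} τ j = toℕ j ≢ 0 ×
  ((suc (toℕ j) < n × BelowAt τ j (toℕ j ∸ 1) × BelowAt τ j (suc (toℕ j)))
   ⊎ (suc (toℕ j) ≡ n × BelowAt τ j (toℕ j ∸ 1)))

module _ {n} {σ σ̂ : Permutation′ n} (hat : IsHat σ σ̂) where

  private
    h : Fin n → Fin n
    h = σ̂ ⟨$⟩ʳ_

  IsHat-reflects-< : ∀ {i p a qa b qb} → IsΠ σ (h i) a qa → IsΠ σ (h p) b qb →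
                     LexLt (toℕ a , qa) (toℕ b , qb) → toℕ i < toℕ p
  IsHat-reflects-< {i} {p} Πi Πp lt with <-cmp (toℕ i) (toℕ p)
  ... | tri< i<p _ _ = i<p
  ... | tri> _ _ p<i = contradiction (hat p i p<i _ _ _ _ Πp Πi) (LexLt-asym lt)
  ... | tri≈ _ i≡p _ with toℕ-injective i≡p
  ...   | refl with Π-unique σ Πi Πp
  ...     | refl , refl = contradiction lt LexLt-irrefl

  consecutive⇒adjacent : ∀ {i p m q} → toℕ i < toℕ p →
                         IsΠ σ (h i) m q → IsΠ σ (h p) m (suc q) → Adjacent i p
  consecutive⇒adjacent {i} {p} i<p Πi Πp with m≤n⇒m<n∨m≡n i<p
  ... | inj₂ adjacent = adjacent
  ... | inj₁ 1+i<p =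
    contradiction (hat r p r<p _ _ _ _ Πr Πp) (LexLt-between (hat i r i<r _ _ _ _ Πi Πr))
    where
    1+i<n = <-trans 1+i<p (toℕ<n p)
    r = fromℕ< 1+i<n
    Πr = proj₂ (proj₂ (Π-exists σ (h r)))
    i<r : toℕ i < toℕ r
    i<r = subst (toℕ i <_) (sym (toℕ-fromℕ< 1+i<n)) ≤-refl
    r<p : toℕ r < toℕ p
    r<p = subst (_< toℕ p) (sym (toℕ-fromℕ< 1+i<n)) 1+i<p

  σ-predecessor : ∀ {p m q} → IsΠ σ (h p) m (suc q) → ∃ λ i → Adjacent i p × σ ⟨$⟩ʳ h p ≡ h i
  σ-predecessor {p} {m} {q} Πp = i , consecutive⇒adjacent i<p Πi Πp , sym h[i]≡σ[h[p]]
    where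
    i = σ̂ ⟨$⟩ˡ (σ ⟨$⟩ʳ h p)
    h[i]≡σ[h[p]] : h i ≡ σ ⟨$⟩ʳ h p
    h[i]≡σ[h[p]] = inverseʳ σ̂
    Πi : IsΠ σ (h i) m q
    Πi = subst (λ y → IsΠ σ y m q) (sym h[i]≡σ[h[p]]) (IsΠ-σ σ Πp)
    i<p = IsHat-reflects-< Πi Πp (inj₂ (refl , n<1+n q))

  block-start-ascends : ∀ {i p m} → Adjacent i p → IsΠ σ (h p) m 0 → toℕ (h i) < toℕ (h p)
  block-start-ascends {i} {p} adjacent Πp@(_ , refl , _) with Π-exists σ (h i)
  ... | a , b , Πi with hat i p (subst (toℕ i <_) adjacent ≤-refl) _ _ _ _ Πi Πp
  ...   | inj₁ a<m       = ≤-<-trans (IsΠ⇒≤ σ Πi) a<m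
  ...   | inj₂ (_ , ())

  σ-predecessor-or-orbit-max : ∀ p → (∃ λ i → Adjacent i p × σ ⟨$⟩ʳ h p ≡ h i)
                                     ⊎ toℕ (σ ⟨$⟩ʳ h p) ≤ toℕ (h p)
  σ-predecessor-or-orbit-max p with Π-exists σ (h p)
  ... | m , suc q , Πp                = inj₁ (σ-predecessor Πp)
  ... | m , zero  , Πp@(_ , refl , _) = inj₂ (IsΠ⇒σ≤ σ Πp)

  adjacent-step : ∀ {i p} → Adjacent i p → σ ⟨$⟩ʳ h p ≡ h i ⊎ toℕ (h i) < toℕ (h p)
  adjacent-step {i} {p} adjacent with Π-exists σ (h p)
  ... | m , zero  , Πp = inj₂ (block-start-ascends adjacent Πp)
  ... | m , suc q , Πp with σ-predecessor Πp
  ...   | i′ , adjacent′ , eq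
    rewrite toℕ-injective {i = i′} {j = i} (suc-injective (trans adjacent′ (sym adjacent))) = inj₁ eq

  ascent⇒σ-predecessor : ∀ {j} → toℕ (h j) < toℕ (σ ⟨$⟩ʳ h j) →
                         ∃ λ i → Adjacent i j × σ ⟨$⟩ʳ h j ≡ h i
  ascent⇒σ-predecessor {j} k<σk =
    [ id , (λ σk≤k → contradiction σk≤k (<⇒≱ k<σk)) ]′ (σ-predecessor-or-orbit-max j)

  σ⁻¹-successor-or-above : ∀ j → (∃ λ p → Adjacent j p × h p ≡ σ ⟨$⟩ˡ h j)
                                 ⊎ toℕ (h j) ≤ toℕ (σ ⟨$⟩ˡ h j)
  σ⁻¹-successor-or-above j = Sum.map successor above (σ-predecessor-or-orbit-max p)
    where
    p = σ̂ ⟨$⟩ˡ (σ ⟨$⟩ˡ h j)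
    h[p]≡σ⁻¹[h[j]] : h p ≡ σ ⟨$⟩ˡ h j
    h[p]≡σ⁻¹[h[j]] = inverseʳ σ̂
    σ[h[p]]≡h[j] : σ ⟨$⟩ʳ h p ≡ h j
    σ[h[p]]≡h[j] = trans (cong (σ ⟨$⟩ʳ_) h[p]≡σ⁻¹[h[j]]) (inverseʳ σ)
    successor : (∃ λ i → Adjacent i p × σ ⟨$⟩ʳ h p ≡ h i) →
                ∃ λ p → Adjacent j p × h p ≡ σ ⟨$⟩ˡ h j
    successor (i , i~p , σ[h[p]]≡h[i]) =
      p , subst (λ i → Adjacent i p) i≡j i~p , h[p]≡σ⁻¹[h[j]]
      where i≡j = ⟨$⟩ʳ-injective σ̂ (trans (sym σ[h[p]]≡h[i]) σ[h[p]]≡h[j])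
    above : toℕ (σ ⟨$⟩ʳ h p) ≤ toℕ (h p) → toℕ (h j) ≤ toℕ (σ ⟨$⟩ˡ h j)
    above = subst₂ (λ x y → toℕ x ≤ toℕ y) σ[h[p]]≡h[j] h[p]≡σ⁻¹[h[j]]

  left-neighbour-above⇒ascent : ∀ {i j} → Adjacent i j → toℕ (h j) < toℕ (h i) →
                                toℕ (h j) < toℕ (σ ⟨$⟩ʳ h j)
  left-neighbour-above⇒ascent i~j k<h[i] with adjacent-step i~j
  ... | inj₁ σk≡h[i] = subst (λ y → toℕ _ < toℕ y) (sym σk≡h[i]) k<h[i]
  ... | inj₂ h[i]<k  = contradiction k<h[i] (<-asym h[i]<k)

  σ⁻¹-above⇒right-neighbour-above : ∀ {j p} → Adjacent j p → toℕ (h j) < toℕ (σ ⟨$⟩ˡ h j) →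
                                    toℕ (h j) < toℕ (h p)
  σ⁻¹-above⇒right-neighbour-above j~p k<σ⁻¹k with adjacent-step j~p
  ... | inj₁ σ[h[p]]≡k =
    subst (λ y → toℕ _ < toℕ y) (trans (cong (σ ⟨$⟩ˡ_) (sym σ[h[p]]≡k)) (inverseˡ σ)) k<σ⁻¹k
  ... | inj₂ k<h[p]    = k<h[p]

  cycleValley⇒wordValley : ∀ {j} → CycleValley σ (h j) → WordValley σ̂ j
  cycleValley⇒wordValley {j} (k<σk , k<σ⁻¹k) with ascent⇒σ-predecessor k<σk
  ... | i , i~j , σk≡h[i] = j≢0 , right-end-or-neighbour (m≤n⇒m<n∨m≡n (toℕ<n j))
    where
    j≢0 : toℕ j ≢ 0
    j≢0 j≡0 = 1+n≢0 (trans i~j j≡0)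
    left : BelowAt σ̂ j (toℕ j ∸ 1)
    left = i , cong (_∸ 1) i~j , subst (λ y → toℕ (h j) < toℕ y) σk≡h[i] k<σk
    right-end-or-neighbour : suc (toℕ j) < n ⊎ suc (toℕ j) ≡ n →
      (suc (toℕ j) < n × BelowAt σ̂ j (toℕ j ∸ 1) × BelowAt σ̂ j (suc (toℕ j)))
      ⊎ (suc (toℕ j) ≡ n × BelowAt σ̂ j (toℕ j ∸ 1))
    right-end-or-neighbour (inj₂ 1+j≡n) = inj₂ (1+j≡n , left)
    right-end-or-neighbour (inj₁ 1+j<n) = inj₁ (1+j<n , left , p , toℕ-fromℕ< 1+j<n ,
      σ⁻¹-above⇒right-neighbour-above (sym (toℕ-fromℕ< 1+j<n)) k<σ⁻¹k)
      where p = fromℕ< 1+j<n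

  wordValley⇒cycleValley : ∀ {j} → WordValley σ̂ j → CycleValley σ (h j)
  wordValley⇒cycleValley {j} (j≢0 , neighbours) = k<σk , k<σ⁻¹k (σ⁻¹-successor-or-above j)
    where
    left : BelowAt σ̂ j (toℕ j ∸ 1)
    left = [ proj₁ ∘ proj₂ , proj₂ ]′ neighbours
    k<σk : toℕ (h j) < toℕ (σ ⟨$⟩ʳ h j)
    k<σk = left-neighbour-above⇒ascent i~j (proj₂ (proj₂ left))
      where i~j = trans (cong suc (proj₁ (proj₂ left))) (suc-pred (toℕ j) {{≢-nonZero j≢0}})
    right-neighbour-above : ∀ {p} → Adjacent j p → toℕ (h j) < toℕ (h p)
    right-neighbour-above {p} j~p = [
      (λ (_ , _ , p′ , p′≡1+j , k<h[p′]) →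
        subst (λ q → toℕ (h j) < toℕ (h q)) (toℕ-injective (trans p′≡1+j j~p)) k<h[p′]) ,
      (λ (1+j≡n , _) → contradiction (toℕ<n p) (<-irrefl (trans (sym j~p) 1+j≡n))) ]′ neighbours
    k<σ⁻¹k : (∃ λ p → Adjacent j p × h p ≡ σ ⟨$⟩ˡ h j) ⊎ toℕ (h j) ≤ toℕ (σ ⟨$⟩ˡ h j) →
             toℕ (h j) < toℕ (σ ⟨$⟩ˡ h j)
    k<σ⁻¹k (inj₂ k≤σ⁻¹k) = ≤∧≢⇒< k≤σ⁻¹k λ k≡σ⁻¹k → <⇒≢ k<σk (cong toℕ (begin
      h j                          ≡⟨ inverseʳ σ ⟨
      σ ⟨$⟩ʳ (σ ⟨$⟩ˡ h j)          ≡⟨ cong (σ ⟨$⟩ʳ_) (toℕ-injective k≡σ⁻¹k) ⟨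
      σ ⟨$⟩ʳ h j                   ∎))
      where open ≡-Reasoning
    k<σ⁻¹k (inj₁ (p , j~p , h[p]≡σ⁻¹k)) =
      subst (λ y → toℕ (h j) < toℕ y) h[p]≡σ⁻¹k (right-neighbour-above j~p)

mainTheorem4 : ∀ (n : ℕ) (σ σ̂ : Permutation′ n) → IsHat σ σ̂ → (j : Fin n) →
    ((toℕ (σ̂ ⟨$⟩ʳ j) < toℕ (σ ⟨$⟩ʳ (σ̂ ⟨$⟩ʳ j))) × (toℕ (σ̂ ⟨$⟩ʳ j) < toℕ (σ ⟨$⟩ˡ (σ̂ ⟨$⟩ʳ j))))
    ⇔ ((toℕ j ≢ 0) ×
       ((suc (toℕ j) < n × BelowAt σ̂ j (toℕ j ∸ 1) × BelowAt σ̂ j (suc (toℕ j)))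
        ⊎ (suc (toℕ j) ≡ n × BelowAt σ̂ j (toℕ j ∸ 1))))
mainTheorem4 n σ σ̂ hat j =
  mk⇔ (cycleValley⇒wordValley {σ = σ} {σ̂} hat) (wordValley⇒cycleValley {σ = σ} {σ̂} hat)
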